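{- Let $K$ be an algebraically closed field of characteristic $0$ with an automorphism $\tau$ of order at most $2$ such that $\tau(\sqrt k)=\sqrt k$ for all $k\in\mathbf N$ with $\sqrt k\in K$. Then for every $k\in\mathbf N$ the Segre homomorphism $s^*:K[\mathbf U]_k\to K[\mathbf X,\mathbf Y]_{(k,k)}$ is a surjective isometry with respect to the inner products described below.
   Context: $\mathbf X=(X_0,\dots,X_n)$, $\mathbf Y=(Y_0,\dots,Y_r)$, $\mathbf U=(U_{ij})_{0\le i\le n,0\le j\le r}$; $s^*(U_{ij})=X_iY_j$. For a polynomial ring in variables $\mathbf Z=(Z_0,\dots,Z_m)$ and $a\in\mathbf N_0$, the $\tau$-inner product on $K[\mathbf Z]_a$ is $\langle\sum_\gamma P_\gamma\mathbf Z^\gamma,\sum_\gamma Q_\gamma\mathbf Z^\gamma\rangle=\sum_\gamma\binom a\gamma^{ -1}P_\gamma\tau(Q_\gamma)$ (multinomial coefficients, $|\gamma|=a$); on $K[\mathbf X,\mathbf Y]_{(a,b)}=K[\mathbf X]_a\otimes K[\mathbf Y]_b$ one uses the tensor product inner product $\langle v\otimes v',w\otimes w'\rangle=\langle v,w\rangle\langle v',w'\rangle$. A linear map $f:V\to W$ between spaces with $\tau$-inner products is called an isometry if $\langle f(v),f(v')\rangle=\langle v,v'\rangle$ for all $v\in(\ker f)^\perp$ and all $v'\in V$, where $\perp$ denotes the orthogonal complement. -}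

module Defs where

open import Level using (Level; _⊔_) renaming (suc to lsuc)
open import Algebra.Bundles using (CommutativeRing)
open import Algebra.Morphism.Structures using (IsRingIsomorphism)
open import Data.Nat as ℕ using (ℕ; zero; suc; _∸_; _≤_)
open import Data.Nat.Combinatorics using (_C_)
open import Data.Fin using (Fin; combine)
open import Data.List as List using (List; []; _∷_; concatMap; upTo)
open import Data.Vec as Vec using (Vec; []; _∷_; lookup; tabulate)
import Data.Vec.Properties as VecP
open import Data.Bool using (if_then_else_; _∧_)
open import Data.Product using (∃; _×_; _,_)
open import Relation.Nullary using (¬_)
open import Relation.Nullary.Decidable using (isYes)
open import Relation.Binary.PropositionalEquality using (_≡_)

-- Fields (no Field bundle in agda-stdlib): a commutative ring with 0 ≉ 1
-- and a (total) inverse function that is a genuine inverse on nonzero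
-- elements.

record Field (c ℓ : Level) : Set (lsuc (c ⊔ ℓ)) where
  field
    commutativeRing : CommutativeRing c ℓ
  open CommutativeRing commutativeRing public
  field
    0≉1   : ¬ (0# ≈ 1#)
    _⁻¹   : Carrier → Carrier
    ⁻¹-inverse : ∀ x → ¬ (x ≈ 0#) → x * (x ⁻¹) ≈ 1#

module FieldNotions {c ℓ : Level} (K : Field c ℓ) where
  open Field K

  fromℕ : ℕ → Carrier
  fromℕ zero    = 0#
  fromℕ (suc n) = 1# + fromℕ n

  _^′_ : Carrier → ℕ → Carrier
  x ^′ zero  = 1#
  x ^′ suc n = x * (x ^′ n)

  sumL : List Carrier → Carrier
  sumL = List.foldr _+_ 0#

  evalCoeffs : {d : ℕ} → Vec Carrier d → Carrier → Carrier
  evalCoeffs []       x = 0#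
  evalCoeffs (a ∷ as) x = a + x * evalCoeffs as x

  CharacteristicZero : Set ℓ
  CharacteristicZero = ∀ n → ¬ (fromℕ (suc n) ≈ 0#)

  -- every monic polynomial of degree d ≥ 1 has a root in K
  -- (equivalently: every nonconstant polynomial has a root)
  AlgebraicallyClosed : Set (c ⊔ ℓ)
  AlgebraicallyClosed =
    ∀ (d : ℕ) (as : Vec Carrier (suc d)) →
      ∃ λ x → (x ^′ suc d) + evalCoeffs as x ≈ 0#

  IsAutomorphism : (Carrier → Carrier) → Set (c ⊔ ℓ)
  IsAutomorphism τ = IsRingIsomorphism rawRing rawRing τ

  OrderAtMost2 : (Carrier → Carrier) → Set (c ⊔ ℓ)
  OrderAtMost2 τ = ∀ x → τ (τ x) ≈ x

  FixesSquareRoots : (Carrier → Carrier) → Set (c ⊔ ℓ)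
  FixesSquareRoots τ = ∀ (k : ℕ) (s : Carrier) → s * s ≈ fromℕ k → τ s ≈ s

-- Monomials: exponent vectors.  A monomial Z^γ of degree a in m variables
-- is γ : Vec ℕ m with Vec.sum γ ≡ a.

monos : (m a : ℕ) → List (Vec ℕ m)
monos zero    zero    = [] ∷ []
monos zero    (suc a) = []
monos (suc m) a = concatMap (λ i → List.map (i ∷_) (monos m (a ∸ i))) (upTo (suc a))

-- multinomial coefficient  binom(a, γ) = a! / ∏ γ_i!
multinomial : {m : ℕ} → ℕ → Vec ℕ m → ℕ
multinomial a []      = 1
multinomial a (g ∷ γ) = (a C g) ℕ.* multinomial (a ∸ g) γ

module Spaces {c ℓ : Level} (K : Field c ℓ) (τ : Field.Carrier K → Field.Carrier K) where
  open Field K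
  open FieldNotions K

  -- K[Z]_a with Z = (Z_1..Z_m): an element is given by its coefficients
  -- P_γ for γ with |γ| = a (values at other γ are ignored)
  Poly : ℕ → Set c
  Poly m = Vec ℕ m → Carrier

  -- bihomogeneous K[X,Y]_{(a,b)} ≅ K[X]_a ⊗ K[Y]_b, coefficient of X^α Y^β
  BiPoly : ℕ → ℕ → Set c
  BiPoly m m′ = Vec ℕ m → Vec ℕ m′ → Carrier

  w : {m : ℕ} → ℕ → Vec ℕ m → Carrier
  w a γ = (fromℕ (multinomial a γ)) ⁻¹

  ip : {m : ℕ} → Poly m → Poly m → ℕ → Carrier
  ip {m} P Q a = sumL (List.map (λ γ → w a γ * (P γ * τ (Q γ))) (monos m a))

  -- tensor-product inner product on K[X]_a ⊗ K[Y]_b, written out on the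
  -- basis X^α ⊗ Y^β = X^α Y^β
  ip₂ : {m m′ : ℕ} → BiPoly m m′ → BiPoly m m′ → ℕ → ℕ → Carrier
  ip₂ {m} {m′} P Q a b =
    sumL (List.map (λ α → sumL (List.map (λ β →
      (w a α * w b β) * (P α β * τ (Q α β))) (monos m′ b))) (monos m a))

module Segre {c ℓ : Level} (K : Field c ℓ) where
  open Field K
  open FieldNotions K

  -- The variable U_{ij} (0 ≤ i ≤ n, 0 ≤ j ≤ r) is the variable with index
  -- combine i j = i·(r+1)+j among the (n+1)(r+1) variables U.
  rowSums : (n r : ℕ) → Vec ℕ (suc n ℕ.* suc r) → Vec ℕ (suc n)
  rowSums n r γ = tabulate (λ i → Vec.sum (tabulate (λ j → lookup γ (combine {suc n} {suc r} i j))))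

  colSums : (n r : ℕ) → Vec ℕ (suc n ℕ.* suc r) → Vec ℕ (suc r)
  colSums n r γ = tabulate (λ j → Vec.sum (tabulate (λ i → lookup γ (combine {suc n} {suc r} i j))))

  -- s*(U_{ij}) = X_i Y_j, so s*(U^γ) = X^{rowSums γ} Y^{colSums γ}; on K[U]_k:
  -- coefficient of X^α Y^β in s*(P) is Σ_{γ, |γ|=k, rows γ = α, cols γ = β} P_γ
  segre : (n r k : ℕ) → (Vec ℕ (suc n ℕ.* suc r) → Carrier) →
          Vec ℕ (suc n) → Vec ℕ (suc r) → Carrier
  segre n r k P α β =
    sumL (List.map (λ γ →
      if isYes (VecP.≡-dec ℕ._≟_ (rowSums n r γ) α) ∧ isYes (VecP.≡-dec ℕ._≟_ (colSums n r γ) β)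
      then P γ else 0#) (monos (suc n ℕ.* suc r) k))

  SegreSurjective : (n r k : ℕ) → Set (c ⊔ ℓ)
  SegreSurjective n r k =
    ∀ (Q : Vec ℕ (suc n) → Vec ℕ (suc r) → Carrier) →
      ∃ λ (P : Vec ℕ (suc n ℕ.* suc r) → Carrier) →
        ∀ α β → Vec.sum α ≡ k → Vec.sum β ≡ k → segre n r k P α β ≈ Q α β

  -- s* : K[U]_k → K[X,Y]_{(k,k)} is an isometry:
  -- ⟨s* v, s* v'⟩ = ⟨v, v'⟩ for v ∈ (ker s*)^⊥ and all v'
  SegreIsometry : (τ : Carrier → Carrier) (n r k : ℕ) → Set (c ⊔ ℓ)
  SegreIsometry τ n r k =
    ∀ (v : Vec ℕ (suc n ℕ.* suc r) → Carrier) →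
      (∀ (u : Vec ℕ (suc n ℕ.* suc r) → Carrier) →
         (∀ α β → Vec.sum α ≡ k → Vec.sum β ≡ k → segre n r k u α β ≈ 0#) →
         ip v u k ≈ 0#) →
      ∀ (v′ : Vec ℕ (suc n ℕ.* suc r) → Carrier) →
        ip₂ (segre n r k v) (segre n r k v′) k k ≈ ip v v′ k
    where open Spaces K τ

module Submission where

-- Write ρ γ and κ γ for the row and column sums of an exponent matrix γ, so
-- that s*(U^γ) = X^(ρ γ) Y^(κ γ).  Everything rests on one counting identity
--   (★)  Σ { binom(k,γ) | |γ| = k, ρ γ = α, κ γ = β } = binom(k,α) · binom(k,β),
-- proved by induction on the number of rows: peel off the first row γ₀,
-- apply the induction hypothesis to the remaining rows (with column sums
-- β − γ₀), and finish with Vandermonde's identity for Σ_{|γ₀|=a₀} ∏ binom(β_j,γ₀_j).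
-- By (★) the map  lift Q (γ) = binom(k,γ) · binom(k,ργ)⁻¹ · binom(k,κγ)⁻¹ · Q(ργ,κγ)
-- is a right inverse of s* (so s* is surjective) and, since τ fixes all
-- rational numbers, it is adjoint to s*:  ⟨v, lift Q⟩ = ⟨s* v, Q⟩.  Hence for
-- v ⊥ ker s* we get, as v′ − lift (s* v′) ∈ ker s*,
--   ⟨v, v′⟩ = ⟨v, lift (s* v′)⟩ = ⟨s* v, s* v′⟩.

open import Defs
open import Level using (Level)
open import Algebra.Bundles using (CommutativeSemiring)
open import Algebra.Morphism.Structures using (IsRingIsomorphism)
open import Data.Bool using (Bool; true; false; _∧_; if_then_else_)
open import Data.Bool.Properties using (∧-assoc; ∧-zeroʳ)
open import Data.Empty using (⊥-elim)
open import Data.Fin using (combine)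
open import Data.List as List using (List; []; _∷_; _++_; concatMap; upTo)
open import Data.List.Properties using (map-upTo)
open import Data.List.Relation.Unary.All as All using (All; []; _∷_)
import Data.List.Relation.Unary.All.Properties as AllP
open import Data.Nat as ℕ using (ℕ; zero; suc; _∸_; _≤_; _<_; z≤n; s≤s; _!; NonZero; _≟_; _≤?_)
import Data.Nat.Properties as ℕₚ
open import Data.Nat.Combinatorics using (_C_; nCk≡n!/k![n-k]!; k![n∸k]!∣n!; k>n⇒nCk≡0; nCk+nC[k+1]≡[n+1]C[k+1])
open import Data.Nat.DivMod using (m/n*n≡m)
open import Data.Nat.Solver using (module +-*-Solver)
open import Data.Product using (_×_; _,_)
open import Data.Vec as Vec using (Vec; []; _∷_; sum; zipWith; tabulate; lookup; splitAt)
import Data.Vec.Properties as VecP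
open import Data.Vec.Relation.Binary.Pointwise.Inductive as Pointwise using (Pointwise; []; _∷_)
open import Function using (_∘_)
open import Relation.Binary.PropositionalEquality as ≡ using (_≡_; _≢_; cong; cong₂)
open import Relation.Nullary using (¬_; Dec; yes; no)
open import Relation.Nullary.Decidable using (isYes)

isYes-⇔ : {A B : Set} (a? : Dec A) (b? : Dec B) → (A → B) → (B → A) → isYes a? ≡ isYes b?
isYes-⇔ (yes a) (yes b) f g = ≡.refl
isYes-⇔ (yes a) (no ¬b) f g = ⊥-elim (¬b (f a))
isYes-⇔ (no ¬a) (yes b) f g = ⊥-elim (¬a (g b))
isYes-⇔ (no ¬a) (no ¬b) f g = ≡.refl

isYes-true : {A : Set} (a? : Dec A) → A → isYes a? ≡ true
isYes-true (yes _) _ = ≡.refl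
isYes-true (no ¬a) a = ⊥-elim (¬a a)

isYes-false : {A : Set} (a? : Dec A) → ¬ A → isYes a? ≡ false
isYes-false (yes a) ¬a = ⊥-elim (¬a a)
isYes-false (no _)  _  = ≡.refl

_≟ᵛ_ : {m : ℕ} (γ δ : Vec ℕ m) → Dec (γ ≡ δ)
_≟ᵛ_ = VecP.≡-dec _≟_

-- Exponent vectors of length m and total degree at most a, generated by the
-- same recursion as `monos`; splitting a vector into two blocks leads to it.
monos≤ : (m a : ℕ) → List (Vec ℕ m)
monos≤ zero    a = [] ∷ []
monos≤ (suc m) a = concatMap (λ i → List.map (i ∷_) (monos≤ m (a ∸ i))) (upTo (suc a))

monos-degree : ∀ m a → All (λ γ → sum γ ≡ a) (monos m a)
monos-degree zero    zero    = ≡.refl ∷ []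
monos-degree zero    (suc a) = []
monos-degree (suc m) a = AllP.concat⁺ (AllP.map⁺ (AllP.applyUpTo⁺₁ _ (suc a) λ {i} i≤a →
  AllP.map⁺ (All.map (λ e → ≡.trans (cong (i ℕ.+_) e) (ℕₚ.m+[n∸m]≡n (ℕₚ.≤-pred i≤a)))
                      (monos-degree m (a ∸ i)))))

module ListSum {c ℓ : Level} (R : CommutativeSemiring c ℓ) where

  open CommutativeSemiring R
  open import Algebra.Properties.CommutativeSemigroup +-commutativeSemigroup
    using () renaming (interchange to +-interchange)
  open import Relation.Binary.Reasoning.Setoid setoid

  -- Σ_{x ∈ xs} f x; the sums `sumL (List.map f xs)` of Defs unfold to this.
  ∑ : {A : Set} → List A → (A → Carrier) → Carrier
  ∑ xs f = List.foldr _+_ 0# (List.map f xs)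

  when : Bool → Carrier → Carrier
  when b x = if b then x else 0#

  ∑-cong : {A : Set} (xs : List A) {f g : A → Carrier} → (∀ x → f x ≈ g x) → ∑ xs f ≈ ∑ xs g
  ∑-cong []       f≈g = refl
  ∑-cong (x ∷ xs) f≈g = +-cong (f≈g x) (∑-cong xs f≈g)

  ∑-cong-All : {A : Set} {P : A → Set} (xs : List A) {f g : A → Carrier} →
               All P xs → (∀ x → P x → f x ≈ g x) → ∑ xs f ≈ ∑ xs g
  ∑-cong-All []       []         f≈g = refl
  ∑-cong-All (x ∷ xs) (px ∷ pxs) f≈g = +-cong (f≈g x px) (∑-cong-All xs pxs f≈g)

  ∑-zero : {A : Set} (xs : List A) {f : A → Carrier} → (∀ x → f x ≈ 0#) → ∑ xs f ≈ 0#
  ∑-zero []       f≈0 = refl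
  ∑-zero (x ∷ xs) f≈0 = trans (+-cong (f≈0 x) (∑-zero xs f≈0)) (+-identityˡ 0#)

  ∑-++ : {A : Set} (xs ys : List A) (f : A → Carrier) → ∑ (xs ++ ys) f ≈ ∑ xs f + ∑ ys f
  ∑-++ []       ys f = sym (+-identityˡ _)
  ∑-++ (x ∷ xs) ys f = trans (+-cong refl (∑-++ xs ys f)) (sym (+-assoc _ _ _))

  ∑-map : {A B : Set} (g : A → B) (xs : List A) (f : B → Carrier) → ∑ (List.map g xs) f ≈ ∑ xs (f ∘ g)
  ∑-map g []       f = refl
  ∑-map g (x ∷ xs) f = +-cong refl (∑-map g xs f)

  ∑-concatMap : {A B : Set} (h : A → List B) (xs : List A) (f : B → Carrier) →
                ∑ (concatMap h xs) f ≈ ∑ xs (λ x → ∑ (h x) f)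
  ∑-concatMap h []       f = refl
  ∑-concatMap h (x ∷ xs) f = trans (∑-++ (h x) (concatMap h xs) f) (+-cong refl (∑-concatMap h xs f))

  ∑-+ : {A : Set} (xs : List A) (f g : A → Carrier) → ∑ xs (λ x → f x + g x) ≈ ∑ xs f + ∑ xs g
  ∑-+ []       f g = sym (+-identityˡ _)
  ∑-+ (x ∷ xs) f g = trans (+-cong refl (∑-+ xs f g)) (+-interchange _ _ _ _)

  ∑-*ˡ : {A : Set} (xs : List A) (f : A → Carrier) (y : Carrier) → ∑ xs (λ x → y * f x) ≈ y * ∑ xs f
  ∑-*ˡ []       f y = sym (zeroʳ y)
  ∑-*ˡ (x ∷ xs) f y = trans (+-cong refl (∑-*ˡ xs f y)) (sym (distribˡ y _ _))

  ∑-*ʳ : {A : Set} (xs : List A) (f : A → Carrier) (y : Carrier) → ∑ xs (λ x → f x * y) ≈ ∑ xs f * y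
  ∑-*ʳ []       f y = sym (zeroˡ y)
  ∑-*ʳ (x ∷ xs) f y = trans (+-cong refl (∑-*ʳ xs f y)) (sym (distribʳ y _ _))

  ∑-swap : {A B : Set} (xs : List A) (ys : List B) (f : A → B → Carrier) →
           ∑ xs (λ x → ∑ ys (f x)) ≈ ∑ ys (λ y → ∑ xs (λ x → f x y))
  ∑-swap []       ys f = sym (∑-zero ys (λ _ → refl))
  ∑-swap (x ∷ xs) ys f = trans (+-cong refl (∑-swap xs ys f)) (sym (∑-+ ys (f x) _))

  when-cong : (b : Bool) {x y : Carrier} → x ≈ y → when b x ≈ when b y
  when-cong true  x≈y = x≈y
  when-cong false x≈y = refl

  when-*ˡ : (b : Bool) (x y : Carrier) → y * when b x ≈ when b (y * x)
  when-*ˡ true  x y = refl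
  when-*ˡ false x y = zeroʳ y

  when-∧ : (b b′ : Bool) (x : Carrier) → when (b ∧ b′) x ≈ when b (when b′ x)
  when-∧ true  b′ x = refl
  when-∧ false b′ x = refl

  ∑-when : {A : Set} (xs : List A) (b : Bool) (f : A → Carrier) → ∑ xs (λ x → when b (f x)) ≈ when b (∑ xs f)
  ∑-when xs true  f = refl
  ∑-when xs false f = ∑-zero xs (λ _ → refl)

  ∑-upTo-suc : ∀ n (f : ℕ → Carrier) → ∑ (upTo (suc n)) f ≈ f 0 + ∑ (upTo n) (f ∘ suc)
  ∑-upTo-suc n f = +-cong refl (trans (reflexive (cong (λ xs → ∑ xs f) (≡.sym (map-upTo suc n))))
                                      (∑-map suc (upTo n) f))

  ∑-upTo-delta : ∀ n d (f : ℕ → Carrier) → d < n → (∀ i → i ≢ d → f i ≈ 0#) → ∑ (upTo n) f ≈ f d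
  ∑-upTo-delta (suc n) zero f _ off = begin
    ∑ (upTo (suc n)) f              ≈⟨ ∑-upTo-suc n f ⟩
    f 0 + ∑ (upTo n) (f ∘ suc)      ≈⟨ +-cong refl (∑-zero (upTo n) (λ i → off (suc i) (λ ()))) ⟩
    f 0 + 0#                        ≈⟨ +-identityʳ _ ⟩
    f 0                             ∎
  ∑-upTo-delta (suc n) (suc d) f (s≤s d<n) off = begin
    ∑ (upTo (suc n)) f              ≈⟨ ∑-upTo-suc n f ⟩
    f 0 + ∑ (upTo n) (f ∘ suc)      ≈⟨ +-cong (off 0 (λ ())) (∑-upTo-delta n d (f ∘ suc) d<n
                                         (λ i i≢d → off (suc i) (i≢d ∘ ℕₚ.suc-injective))) ⟩
    0# + f (suc d)                  ≈⟨ +-identityˡ _ ⟩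
    f (suc d)                       ∎

  ∑-upTo-truncate : ∀ b a (f g : ℕ → Carrier) → b ≤ a →
                    (∀ i → i ≤ b → f i ≈ g i) → (∀ i → b < i → f i ≈ 0#) →
                    ∑ (upTo (suc a)) f ≈ ∑ (upTo (suc b)) g
  ∑-upTo-truncate zero a f g _ f≈g off = begin
    ∑ (upTo (suc a)) f              ≈⟨ ∑-upTo-suc a f ⟩
    f 0 + ∑ (upTo a) (f ∘ suc)      ≈⟨ +-cong (f≈g 0 z≤n) (∑-zero (upTo a) (λ i → off (suc i) (s≤s z≤n))) ⟩
    g 0 + 0#                        ≈⟨ sym (∑-upTo-suc 0 g) ⟩
    ∑ (upTo 1) g                    ∎
  ∑-upTo-truncate (suc b) (suc a) f g (s≤s b≤a) f≈g off = begin
    ∑ (upTo (suc (suc a))) f        ≈⟨ ∑-upTo-suc (suc a) f ⟩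
    f 0 + ∑ (upTo (suc a)) (f ∘ suc) ≈⟨ +-cong (f≈g 0 z≤n) (∑-upTo-truncate b a (f ∘ suc) (g ∘ suc) b≤a
                                           (λ i i≤b → f≈g (suc i) (s≤s i≤b)) (λ i b<i → off (suc i) (s≤s b<i))) ⟩
    g 0 + ∑ (upTo (suc b)) (g ∘ suc) ≈⟨ sym (∑-upTo-suc (suc b) g) ⟩
    ∑ (upTo (suc (suc b))) g        ∎

  ∑-first : ∀ {m} a (vs : ℕ → List (Vec ℕ m)) (f : Vec ℕ (suc m) → Carrier) →
            ∑ (concatMap (λ i → List.map (i ∷_) (vs i)) (upTo (suc a))) f ≈
            ∑ (upTo (suc a)) (λ i → ∑ (vs i) (λ γ → f (i ∷ γ)))
  ∑-first a vs f = trans (∑-concatMap (λ i → List.map (i ∷_) (vs i)) (upTo (suc a)) f)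
                         (∑-cong (upTo (suc a)) (λ i → ∑-map (i ∷_) (vs i) f))

  ∑-split : ∀ m₁ m₂ a (f : Vec ℕ (m₁ ℕ.+ m₂) → Carrier) →
            ∑ (monos (m₁ ℕ.+ m₂) a) f ≈
            ∑ (monos≤ m₁ a) (λ γ₁ → ∑ (monos m₂ (a ∸ sum γ₁)) (λ γ₂ → f (γ₁ Vec.++ γ₂)))
  ∑-split zero     m₂ a f = sym (+-identityʳ _)
  ∑-split (suc m₁) m₂ a f = begin
    ∑ (monos (suc m₁ ℕ.+ m₂) a) f
      ≈⟨ ∑-first a (λ i → monos (m₁ ℕ.+ m₂) (a ∸ i)) f ⟩
    ∑ (upTo (suc a)) (λ i → ∑ (monos (m₁ ℕ.+ m₂) (a ∸ i)) (λ γ → f (i ∷ γ)))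
      ≈⟨ ∑-cong (upTo (suc a)) (λ i → trans (∑-split m₁ m₂ (a ∸ i) (f ∘ (i ∷_)))
           (∑-cong (monos≤ m₁ (a ∸ i)) (λ γ₁ → reflexive
             (cong (λ d → ∑ (monos m₂ d) (λ γ₂ → f (i ∷ (γ₁ Vec.++ γ₂)))) (ℕₚ.∸-+-assoc a i (sum γ₁)))))) ⟩
    ∑ (upTo (suc a)) (λ i → ∑ (monos≤ m₁ (a ∸ i)) (λ γ₁ →
      ∑ (monos m₂ (a ∸ (i ℕ.+ sum γ₁))) (λ γ₂ → f (i ∷ (γ₁ Vec.++ γ₂)))))
      ≈⟨ sym (∑-first a (λ i → monos≤ m₁ (a ∸ i)) _) ⟩
    ∑ (monos≤ (suc m₁) a) (λ γ₁ → ∑ (monos m₂ (a ∸ sum γ₁)) (λ γ₂ → f (γ₁ Vec.++ γ₂))) ∎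

  ∑-restrict : ∀ m a b (G : Vec ℕ m → Carrier) → b ≤ a →
               ∑ (monos≤ m a) (λ γ → when (isYes (sum γ ≟ b)) (G γ)) ≈ ∑ (monos m b) G
  ∑-restrict zero    a zero    G _   = refl
  ∑-restrict zero    a (suc b) G _   = +-identityʳ _
  ∑-restrict (suc m) a b       G b≤a = begin
    ∑ (monos≤ (suc m) a) (λ γ → when (isYes (sum γ ≟ b)) (G γ))
      ≈⟨ ∑-first a (λ i → monos≤ m (a ∸ i)) _ ⟩
    ∑ (upTo (suc a)) (λ i → ∑ (monos≤ m (a ∸ i)) (λ γ → when (isYes ((i ℕ.+ sum γ) ≟ b)) (G (i ∷ γ))))
      ≈⟨ ∑-upTo-truncate b a _ _ b≤a within beyond ⟩
    ∑ (upTo (suc b)) (λ i → ∑ (monos m (b ∸ i)) (λ γ → G (i ∷ γ)))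
      ≈⟨ sym (∑-first b (λ i → monos m (b ∸ i)) G) ⟩
    ∑ (monos (suc m) b) G ∎
    where
    within : ∀ i → i ≤ b → ∑ (monos≤ m (a ∸ i)) (λ γ → when (isYes ((i ℕ.+ sum γ) ≟ b)) (G (i ∷ γ)))
                         ≈ ∑ (monos m (b ∸ i)) (λ γ → G (i ∷ γ))
    within i i≤b = trans (∑-cong (monos≤ m (a ∸ i)) (λ γ → reflexive (cong (λ t → when t (G (i ∷ γ)))
                     (isYes-⇔ ((i ℕ.+ sum γ) ≟ b) (sum γ ≟ (b ∸ i))
                        (λ e → ≡.trans (≡.sym (ℕₚ.m+n∸m≡n i (sum γ))) (cong (_∸ i) e))
                        (λ e → ≡.trans (cong (i ℕ.+_) e) (ℕₚ.m+[n∸m]≡n i≤b))))))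
                   (∑-restrict m (a ∸ i) (b ∸ i) (G ∘ (i ∷_)) (ℕₚ.∸-monoˡ-≤ i b≤a))
    beyond : ∀ i → b < i → ∑ (monos≤ m (a ∸ i)) (λ γ → when (isYes ((i ℕ.+ sum γ) ≟ b)) (G (i ∷ γ))) ≈ 0#
    beyond i b<i = ∑-zero (monos≤ m (a ∸ i)) (λ γ → reflexive (cong (λ t → when t (G (i ∷ γ)))
                     (isYes-false ((i ℕ.+ sum γ) ≟ b) (λ e → ℕₚ.<⇒≱ b<i (≡.subst (i ≤_) e (ℕₚ.m≤m+n i _))))))

  ∑-delta : ∀ m a (δ : Vec ℕ m) (x : Carrier) → sum δ ≡ a → ∑ (monos m a) (λ γ → when (isYes (δ ≟ᵛ γ)) x) ≈ x
  ∑-delta zero    .0 []      x ≡.refl = +-identityʳ x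
  ∑-delta (suc m) a  (d ∷ δ) x e    = begin
    ∑ (monos (suc m) a) (λ γ → when (isYes ((d ∷ δ) ≟ᵛ γ)) x)
      ≈⟨ ∑-first a (λ i → monos m (a ∸ i)) _ ⟩
    ∑ (upTo (suc a)) term
      ≈⟨ ∑-upTo-delta (suc a) d term (s≤s (≡.subst (d ≤_) e (ℕₚ.m≤m+n d _))) off ⟩
    term d
      ≈⟨ ∑-cong (monos m (a ∸ d)) (λ γ → reflexive (cong (λ t → when t x)
           (isYes-⇔ ((d ∷ δ) ≟ᵛ (d ∷ γ)) (δ ≟ᵛ γ) VecP.∷-injectiveʳ (cong (d ∷_))))) ⟩
    ∑ (monos m (a ∸ d)) (λ γ → when (isYes (δ ≟ᵛ γ)) x)
      ≈⟨ ∑-delta m (a ∸ d) δ x (≡.trans (≡.sym (ℕₚ.m+n∸m≡n d _)) (cong (_∸ d) e)) ⟩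
    x ∎
    where
    term : ℕ → Carrier
    term i = ∑ (monos m (a ∸ i)) (λ γ → when (isYes ((d ∷ δ) ≟ᵛ (i ∷ γ))) x)
    off : ∀ i → i ≢ d → term i ≈ 0#
    off i i≢d = ∑-zero (monos m (a ∸ i)) (λ γ → reflexive (cong (λ t → when t x)
                  (isYes-false ((d ∷ δ) ≟ᵛ (i ∷ γ)) (λ eq → i≢d (≡.sym (VecP.∷-injectiveˡ eq))))))

module Multinomial where

  open import Data.Nat using (_+_; _*_)
  open ℕₚ
  open +-*-Solver
  open ≡.≡-Reasoning
  open ListSum +-*-commutativeSemiring using (∑; ∑-cong; ∑-zero; ∑-+; ∑-*ˡ; ∑-upTo-suc; ∑-first)

  binomial-factorial : ∀ {n k} → k ≤ n → (n C k) * (k ! * (n ∸ k) !) ≡ n !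
  binomial-factorial {n} {k} k≤n =
    ≡.trans (cong (_* (k ! * (n ∸ k) !)) (nCk≡n!/k![n-k]! k≤n)) (m/n*n≡m {{k !* (n ∸ k) !≢0}} (k![n∸k]!∣n! k≤n))

  factorials : {m : ℕ} → Vec ℕ m → ℕ
  factorials []      = 1
  factorials (g ∷ γ) = g ! * factorials γ

  factorials-nonZero : ∀ {m} (γ : Vec ℕ m) → NonZero (factorials γ)
  factorials-nonZero []      = _
  factorials-nonZero (g ∷ γ) = m*n≢0 (g !) (factorials γ) {{g !≢0}} {{factorials-nonZero γ}}

  multinomial-factorial : ∀ {m} a (γ : Vec ℕ m) → sum γ ≤ a →
                          multinomial a γ * (factorials γ * (a ∸ sum γ) !) ≡ a !
  multinomial-factorial a []      _   = ≡.trans (+-identityʳ _) (+-identityʳ _)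
  multinomial-factorial a (g ∷ γ) |γ|≤a = begin
      ((a C g) * M) * ((g ! * F) * (a ∸ (g + sum γ)) !)
        ≡⟨ cong (λ d → ((a C g) * M) * ((g ! * F) * d !)) (≡.sym (∸-+-assoc a g (sum γ))) ⟩
      ((a C g) * M) * ((g ! * F) * ((a ∸ g) ∸ sum γ) !)
        ≡⟨ solve 5 (λ c m f g! h → (c :* m) :* ((g! :* f) :* h) := c :* (g! :* (m :* (f :* h))))
                 ≡.refl (a C g) M F (g !) (((a ∸ g) ∸ sum γ) !) ⟩
      (a C g) * (g ! * (M * (F * ((a ∸ g) ∸ sum γ) !)))
        ≡⟨ cong (λ t → (a C g) * (g ! * t)) (multinomial-factorial (a ∸ g) γ |γ|≤a∸g) ⟩
      (a C g) * (g ! * (a ∸ g) !)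
        ≡⟨ binomial-factorial (≤-trans (m≤m+n g (sum γ)) |γ|≤a) ⟩
      a ! ∎
    where
    M = multinomial (a ∸ g) γ
    F = factorials γ
    |γ|≤a∸g : sum γ ≤ a ∸ g
    |γ|≤a∸g = m+n≤o⇒m≤o∸n (sum γ) (≡.subst (_≤ a) (+-comm g (sum γ)) |γ|≤a)

  multinomial-exact : ∀ {m} a (γ : Vec ℕ m) → sum γ ≡ a → multinomial a γ * factorials γ ≡ a !
  multinomial-exact a γ |γ|≡a = begin
      multinomial a γ * factorials γ               ≡⟨ cong (multinomial a γ *_) (≡.sym (*-identityʳ (factorials γ))) ⟩
      multinomial a γ * (factorials γ * 0 !)       ≡⟨ cong (λ d → multinomial a γ * (factorials γ * d !))
                                                        (≡.sym (≡.trans (cong (a ∸_) |γ|≡a) (n∸n≡0 a))) ⟩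
      multinomial a γ * (factorials γ * (a ∸ sum γ) !) ≡⟨ multinomial-factorial a γ (≤-reflexive |γ|≡a) ⟩
      a ! ∎

  multinomial≢0 : ∀ {m} a (γ : Vec ℕ m) → sum γ ≡ a → multinomial a γ ≢ 0
  multinomial≢0 a γ |γ|≡a eq = ℕ.≢-nonZero⁻¹ (a !) {{a !≢0}}
    (≡.trans (≡.sym (multinomial-exact a γ |γ|≡a)) (cong (_* factorials γ) eq))

  multinomial-zero : ∀ {m} (γ : Vec ℕ m) → sum γ ≡ 0 → multinomial 0 γ ≡ 1
  multinomial-zero γ |γ|≡0 = m*n≡1⇒m≡1 _ _ (multinomial-exact 0 γ |γ|≡0)

  multinomial-++ : ∀ {m₁ m₂} a (γ₁ : Vec ℕ m₁) (γ₂ : Vec ℕ m₂) →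
                   multinomial a (γ₁ Vec.++ γ₂) ≡ multinomial a γ₁ * multinomial (a ∸ sum γ₁) γ₂
  multinomial-++ a []       γ₂ = ≡.sym (+-identityʳ _)
  multinomial-++ a (g ∷ γ₁) γ₂ = begin
      (a C g) * multinomial (a ∸ g) (γ₁ Vec.++ γ₂)
        ≡⟨ cong ((a C g) *_) (multinomial-++ (a ∸ g) γ₁ γ₂) ⟩
      (a C g) * (multinomial (a ∸ g) γ₁ * multinomial ((a ∸ g) ∸ sum γ₁) γ₂)
        ≡⟨ ≡.sym (*-assoc (a C g) _ _) ⟩
      ((a C g) * multinomial (a ∸ g) γ₁) * multinomial ((a ∸ g) ∸ sum γ₁) γ₂
        ≡⟨ cong (λ d → ((a C g) * multinomial (a ∸ g) γ₁) * multinomial d γ₂) (∸-+-assoc a g (sum γ₁)) ⟩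
      ((a C g) * multinomial (a ∸ g) γ₁) * multinomial (a ∸ (g + sum γ₁)) γ₂ ∎

  _≤ᵛ_ : {m : ℕ} → Vec ℕ m → Vec ℕ m → Set
  _≤ᵛ_ = Pointwise _≤_

  _∸ᵛ_ : {m : ℕ} → Vec ℕ m → Vec ℕ m → Vec ℕ m
  _∸ᵛ_ = zipWith _∸_

  sum-mono-≤ᵛ : ∀ {m} {γ β : Vec ℕ m} → γ ≤ᵛ β → sum γ ≤ sum β
  sum-mono-≤ᵛ []            = z≤n
  sum-mono-≤ᵛ (g≤b ∷ γ≤β) = +-mono-≤ g≤b (sum-mono-≤ᵛ γ≤β)

  sum-∸ᵛ : ∀ {m} (β γ : Vec ℕ m) → γ ≤ᵛ β → sum (β ∸ᵛ γ) ≡ sum β ∸ sum γ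
  sum-∸ᵛ []      []      []            = ≡.refl
  sum-∸ᵛ (b ∷ β) (g ∷ γ) (g≤b ∷ γ≤β) = begin
      (b ∸ g) + sum (β ∸ᵛ γ)       ≡⟨ cong ((b ∸ g) +_) (sum-∸ᵛ β γ γ≤β) ⟩
      (b ∸ g) + (sum β ∸ sum γ)    ≡⟨ ≡.sym (+-∸-assoc (b ∸ g) (sum-mono-≤ᵛ γ≤β)) ⟩
      ((b ∸ g) + sum β) ∸ sum γ    ≡⟨ cong (_∸ sum γ) (≡.sym (+-∸-comm (sum β) g≤b)) ⟩
      ((b + sum β) ∸ g) ∸ sum γ    ≡⟨ ∸-+-assoc (b + sum β) g (sum γ) ⟩
      (b + sum β) ∸ (g + sum γ)    ∎

  binomials : {m : ℕ} → Vec ℕ m → Vec ℕ m → ℕ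
  binomials []      []      = 1
  binomials (b ∷ β) (g ∷ γ) = (b C g) * binomials β γ

  binomials-factorial : ∀ {m} (β γ : Vec ℕ m) → γ ≤ᵛ β →
                        binomials β γ * (factorials γ * factorials (β ∸ᵛ γ)) ≡ factorials β
  binomials-factorial []      []      []            = ≡.refl
  binomials-factorial (b ∷ β) (g ∷ γ) (g≤b ∷ γ≤β) = begin
      ((b C g) * B) * ((g ! * F) * ((b ∸ g) ! * F′))
        ≡⟨ solve 6 (λ c p f₀ f₁ h₀ h₁ → (c :* p) :* ((f₀ :* f₁) :* (h₀ :* h₁))
                                     := (c :* (f₀ :* h₀)) :* (p :* (f₁ :* h₁)))
                 ≡.refl (b C g) B (g !) F ((b ∸ g) !) F′ ⟩
      ((b C g) * (g ! * (b ∸ g) !)) * (B * (F * F′))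
        ≡⟨ cong₂ _*_ (binomial-factorial g≤b) (binomials-factorial β γ γ≤β) ⟩
      b ! * factorials β ∎
    where
    B  = binomials β γ
    F  = factorials γ
    F′ = factorials (β ∸ᵛ γ)

  binomials-≰ : ∀ {m} (β γ : Vec ℕ m) → ¬ γ ≤ᵛ β → binomials β γ ≡ 0
  binomials-≰ []      []      γ≰β = ⊥-elim (γ≰β [])
  binomials-≰ (b ∷ β) (g ∷ γ) γ≰β with g ≤? b
  ... | yes g≤b = ≡.trans (cong ((b C g) *_) (binomials-≰ β γ (γ≰β ∘ (g≤b ∷_)))) (*-zeroʳ (b C g))
  ... | no  g≰b = cong (_* binomials β γ) (k>n⇒nCk≡0 (≰⇒> g≰b))

  multinomial-∸ᵛ : ∀ {m} a b (β γ : Vec ℕ m) → γ ≤ᵛ β → sum β ≡ a → sum γ ≡ b →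
                   multinomial a γ * multinomial (a ∸ b) (β ∸ᵛ γ) ≡ multinomial a β * binomials β γ
  multinomial-∸ᵛ a b β γ γ≤β |β|≡a |γ|≡b = *-cancelʳ-≡ _ _ D {{D-nonZero}} (begin
      (X * Y) * ((Fγ * Fδ) * E)     ≡⟨ solve 5 (λ x y p q e → (x :* y) :* ((p :* q) :* e) := (x :* (p :* e)) :* (y :* q))
                                           ≡.refl X Y Fγ Fδ E ⟩
      (X * (Fγ * E)) * (Y * Fδ)     ≡⟨ cong₂ _*_ first-row (multinomial-exact (a ∸ b) (β ∸ᵛ γ) |β∸γ|≡a∸b) ⟩
      a ! * E                       ≡⟨ cong (_* E) (≡.sym (multinomial-exact a β |β|≡a)) ⟩
      (Mβ * factorials β) * E       ≡⟨ cong (λ t → (Mβ * t) * E) (≡.sym (binomials-factorial β γ γ≤β)) ⟩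
      (Mβ * (Bβγ * (Fγ * Fδ))) * E  ≡⟨ solve 5 (λ m c p q e → (m :* (c :* (p :* q))) :* e := (m :* c) :* ((p :* q) :* e))
                                           ≡.refl Mβ Bβγ Fγ Fδ E ⟩
      (Mβ * Bβγ) * ((Fγ * Fδ) * E)  ∎)
    where
    X   = multinomial a γ
    Y   = multinomial (a ∸ b) (β ∸ᵛ γ)
    Mβ  = multinomial a β
    Bβγ = binomials β γ
    Fγ  = factorials γ
    Fδ  = factorials (β ∸ᵛ γ)
    E   = (a ∸ b) !
    D   = (Fγ * Fδ) * E
    D-nonZero : NonZero D
    D-nonZero = m*n≢0 (Fγ * Fδ) E {{m*n≢0 Fγ Fδ {{factorials-nonZero γ}} {{factorials-nonZero (β ∸ᵛ γ)}}}}
                                  {{(a ∸ b) !≢0}}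
    |β∸γ|≡a∸b : sum (β ∸ᵛ γ) ≡ a ∸ b
    |β∸γ|≡a∸b = ≡.trans (sum-∸ᵛ β γ γ≤β) (cong₂ _∸_ |β|≡a |γ|≡b)
    first-row : X * (Fγ * E) ≡ a !
    first-row = ≡.trans (cong (λ d → X * (Fγ * (a ∸ d) !)) (≡.sym |γ|≡b))
                        (multinomial-factorial a γ (≡.subst (sum γ ≤_) |β|≡a (sum-mono-≤ᵛ γ≤β)))

  vandermonde : ∀ b B a → ∑ (upTo (suc a)) (λ i → (b C i) * (B C (a ∸ i))) ≡ (b + B) C a
  vandermonde zero B a = begin
      ∑ (upTo (suc a)) (λ i → (0 C i) * (B C (a ∸ i)))
        ≡⟨ ∑-upTo-suc a (λ i → (0 C i) * (B C (a ∸ i))) ⟩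
      1 * (B C a) + ∑ (upTo a) (λ i → (0 C suc i) * (B C (a ∸ suc i)))
        ≡⟨ cong (1 * (B C a) +_) (∑-zero (upTo a) (λ _ → ≡.refl)) ⟩
      1 * (B C a) + 0
        ≡⟨ ≡.trans (+-identityʳ _) (*-identityˡ _) ⟩
      B C a ∎
  vandermonde (suc b) B zero    = ≡.refl
  vandermonde (suc b) B (suc a) = begin
      ∑ (upTo (suc (suc a))) (λ i → (suc b C i) * (B C (suc a ∸ i)))
        ≡⟨ ∑-upTo-suc (suc a) (λ i → (suc b C i) * (B C (suc a ∸ i))) ⟩
      1 * Q + ∑ (upTo (suc a)) (λ i → (suc b C suc i) * (B C (a ∸ i)))
        ≡⟨ cong (1 * Q +_) (≡.trans (∑-cong (upTo (suc a)) pascal)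
                                    (∑-+ (upTo (suc a)) (λ i → (b C i) * (B C (a ∸ i))) (λ i → (b C suc i) * (B C (a ∸ i))))) ⟩
      1 * Q + (S₁ + S₂)
        ≡⟨ solve 3 (λ q s₁ s₂ → q :+ (s₁ :+ s₂) := s₁ :+ (q :+ s₂)) ≡.refl (1 * Q) S₁ S₂ ⟩
      S₁ + (1 * Q + S₂)
        ≡⟨ cong₂ _+_ (vandermonde b B a)
                     (≡.trans (≡.sym (∑-upTo-suc (suc a) (λ i → (b C i) * (B C (suc a ∸ i))))) (vandermonde b B (suc a))) ⟩
      ((b + B) C a) + ((b + B) C suc a)
        ≡⟨ nCk+nC[k+1]≡[n+1]C[k+1] (b + B) a ⟩
      (suc b + B) C suc a ∎
    where
    Q  = B C suc a
    S₁ = ∑ (upTo (suc a)) (λ i → (b C i) * (B C (a ∸ i)))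
    S₂ = ∑ (upTo (suc a)) (λ i → (b C suc i) * (B C (a ∸ i)))
    pascal : ∀ i → (suc b C suc i) * (B C (a ∸ i)) ≡ (b C i) * (B C (a ∸ i)) + (b C suc i) * (B C (a ∸ i))
    pascal i = ≡.trans (cong (_* (B C (a ∸ i))) (≡.sym (nCk+nC[k+1]≡[n+1]C[k+1] b i)))
                       (*-distribʳ-+ (B C (a ∸ i)) (b C i) (b C suc i))

  vandermonde-vec : ∀ m (β : Vec ℕ m) a → ∑ (monos m a) (binomials β) ≡ sum β C a
  vandermonde-vec zero    []      zero    = ≡.refl
  vandermonde-vec zero    []      (suc a) = ≡.refl
  vandermonde-vec (suc m) (b ∷ β) a = begin
      ∑ (monos (suc m) a) (binomials (b ∷ β))
        ≡⟨ ∑-first a (λ i → monos m (a ∸ i)) (binomials (b ∷ β)) ⟩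
      ∑ (upTo (suc a)) (λ i → ∑ (monos m (a ∸ i)) (λ γ → (b C i) * binomials β γ))
        ≡⟨ ∑-cong (upTo (suc a)) (λ i → ≡.trans (∑-*ˡ (monos m (a ∸ i)) (binomials β) (b C i))
                                               (cong ((b C i) *_) (vandermonde-vec m β (a ∸ i)))) ⟩
      ∑ (upTo (suc a)) (λ i → (b C i) * (sum β C (a ∸ i)))
        ≡⟨ vandermonde b (sum β) a ⟩
      (b + sum β) C a ∎

module Fibres where

  open import Data.Nat using (_+_; _*_)
  open ℕₚ
  open +-*-Solver
  open ≡.≡-Reasoning
  open Multinomial
  open ListSum +-*-commutativeSemiring

  -- An m × c exponent matrix is stored row by row, entry (i, j) at index
  -- combine i j; for m = n+1, c = r+1 these are the row and column sums of
  -- the Segre map in Defs.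
  rowSums : (m c : ℕ) → Vec ℕ (m * c) → Vec ℕ m
  rowSums m c γ = tabulate (λ i → sum (tabulate (λ j → lookup γ (combine {m} {c} i j))))

  colSums : (m c : ℕ) → Vec ℕ (m * c) → Vec ℕ c
  colSums m c γ = tabulate (λ j → sum (tabulate (λ i → lookup γ (combine {m} {c} i j))))

  _+ᵛ_ : {m : ℕ} → Vec ℕ m → Vec ℕ m → Vec ℕ m
  _+ᵛ_ = zipWith _+_

  rowSums-++ : ∀ m c (γ₀ : Vec ℕ c) (γ : Vec ℕ (m * c)) → rowSums (suc m) c (γ₀ Vec.++ γ) ≡ sum γ₀ ∷ rowSums m c γ
  rowSums-++ m c γ₀ γ = cong₂ _∷_
    (cong sum (≡.trans (VecP.tabulate-cong (λ j → VecP.lookup-++ˡ γ₀ γ j)) (VecP.tabulate∘lookup γ₀)))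
    (VecP.tabulate-cong (λ i → cong sum (VecP.tabulate-cong (λ j → VecP.lookup-++ʳ γ₀ γ (combine i j)))))

  colSums-++ : ∀ m c (γ₀ : Vec ℕ c) (γ : Vec ℕ (m * c)) → colSums (suc m) c (γ₀ Vec.++ γ) ≡ γ₀ +ᵛ colSums m c γ
  colSums-++ m c γ₀ γ = ≡.trans
    (VecP.tabulate-cong (λ j → cong₂ _+_ (VecP.lookup-++ˡ γ₀ γ j)
      (≡.trans (cong sum (VecP.tabulate-cong (λ i → VecP.lookup-++ʳ γ₀ γ (combine {m} {c} i j))))
               (≡.sym (VecP.lookup∘tabulate _ j)))))
    (≡.trans (VecP.tabulate-cong (λ j → ≡.sym (VecP.lookup-zipWith _+_ j γ₀ (colSums m c γ))))
             (VecP.tabulate∘lookup _))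

  sum-zeros : ∀ c → sum (tabulate {c} (λ _ → 0)) ≡ 0
  sum-zeros zero    = ≡.refl
  sum-zeros (suc c) = sum-zeros c

  zeros-unique : ∀ {c} (β : Vec ℕ c) → sum β ≡ 0 → tabulate (λ _ → 0) ≡ β
  zeros-unique []      _      = ≡.refl
  zeros-unique (b ∷ β) |β|≡0 = cong₂ _∷_ (≡.sym (m+n≡0⇒m≡0 b |β|≡0)) (zeros-unique β (m+n≡0⇒n≡0 b |β|≡0))

  sum-+ᵛ : ∀ {c} (xs ys : Vec ℕ c) → sum (xs +ᵛ ys) ≡ sum xs + sum ys
  sum-+ᵛ []       []       = ≡.refl
  sum-+ᵛ (x ∷ xs) (y ∷ ys) = ≡.trans (cong ((x + y) +_) (sum-+ᵛ xs ys))
    (solve 4 (λ x y s t → (x :+ y) :+ (s :+ t) := (x :+ s) :+ (y :+ t)) ≡.refl x y (sum xs) (sum ys))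

  sum-rowSums : ∀ m c (γ : Vec ℕ (m * c)) → sum (rowSums m c γ) ≡ sum γ
  sum-rowSums zero    c [] = ≡.refl
  sum-rowSums (suc m) c γ with splitAt c γ
  ... | γ₀ , γ′ , ≡.refl = ≡.trans (cong sum (rowSums-++ m c γ₀ γ′))
                             (≡.trans (cong (sum γ₀ +_) (sum-rowSums m c γ′)) (≡.sym (VecP.sum-++ γ₀)))

  sum-colSums : ∀ m c (γ : Vec ℕ (m * c)) → sum (colSums m c γ) ≡ sum γ
  sum-colSums zero    c [] = sum-zeros c
  sum-colSums (suc m) c γ with splitAt c γ
  ... | γ₀ , γ′ , ≡.refl = ≡.trans (cong sum (colSums-++ m c γ₀ γ′))
                             (≡.trans (sum-+ᵛ γ₀ (colSums m c γ′))
                               (≡.trans (cong (sum γ₀ +_) (sum-colSums m c γ′)) (≡.sym (VecP.sum-++ γ₀))))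

  +ᵛ≡⇒≤ᵛ : ∀ {c} (γ₀ δ β : Vec ℕ c) → γ₀ +ᵛ δ ≡ β → γ₀ ≤ᵛ β
  +ᵛ≡⇒≤ᵛ []       []      []      _  = []
  +ᵛ≡⇒≤ᵛ (g ∷ γ₀) (d ∷ δ) (b ∷ β) eq =
    ≡.subst (g ≤_) (VecP.∷-injectiveˡ eq) (m≤m+n g d) ∷ +ᵛ≡⇒≤ᵛ γ₀ δ β (VecP.∷-injectiveʳ eq)

  +ᵛ≡⇒∸ᵛ : ∀ {c} (γ₀ δ β : Vec ℕ c) → γ₀ +ᵛ δ ≡ β → δ ≡ β ∸ᵛ γ₀
  +ᵛ≡⇒∸ᵛ []       []      []      _  = ≡.refl
  +ᵛ≡⇒∸ᵛ (g ∷ γ₀) (d ∷ δ) (b ∷ β) eq =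
    cong₂ _∷_ (≡.trans (≡.sym (m+n∸m≡n g d)) (cong (_∸ g) (VecP.∷-injectiveˡ eq)))
              (+ᵛ≡⇒∸ᵛ γ₀ δ β (VecP.∷-injectiveʳ eq))

  +ᵛ-∸ᵛ : ∀ {c} (γ₀ β : Vec ℕ c) → γ₀ ≤ᵛ β → γ₀ +ᵛ (β ∸ᵛ γ₀) ≡ β
  +ᵛ-∸ᵛ []       []      []            = ≡.refl
  +ᵛ-∸ᵛ (g ∷ γ₀) (b ∷ β) (g≤b ∷ γ₀≤β) = cong₂ _∷_ (m+[n∸m]≡n g≤b) (+ᵛ-∸ᵛ γ₀ β γ₀≤β)

  inFibre : ∀ m c → Vec ℕ m → Vec ℕ c → Vec ℕ (m * c) → Bool
  inFibre m c α β γ = isYes (rowSums m c γ ≟ᵛ α) ∧ isYes (colSums m c γ ≟ᵛ β)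

  FibreIdentity : ℕ → ℕ → Set
  FibreIdentity m c = ∀ a (α : Vec ℕ m) (β : Vec ℕ c) → sum α ≡ a → sum β ≡ a →
    ∑ (monos (m * c) a) (λ γ → when (inFibre m c α β γ) (multinomial a γ)) ≡ multinomial a α * multinomial a β

  -- With no rows the only matrix is empty; its column sums vanish.
  fibre-identity-zero : ∀ c → FibreIdentity 0 c
  fibre-identity-zero c .0 [] β ≡.refl |β|≡0 = begin
      when (isYes (tabulate (λ _ → 0) ≟ᵛ β)) 1 + 0
        ≡⟨ cong (λ t → when t 1 + 0) (isYes-true (tabulate (λ _ → 0) ≟ᵛ β) (zeros-unique β |β|≡0)) ⟩
      1
        ≡⟨ ≡.sym (≡.trans (+-identityʳ _) (multinomial-zero β |β|≡0)) ⟩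
      1 * multinomial 0 β ∎

  belowFirstRow : ∀ m c → Vec ℕ m → Vec ℕ c → Vec ℕ c → Vec ℕ (m * c) → Bool
  belowFirstRow m c α β γ₀ γ = isYes (rowSums m c γ ≟ᵛ α) ∧ isYes ((γ₀ +ᵛ colSums m c γ) ≟ᵛ β)

  inFibre-++ : ∀ m c a₀ α β (γ₀ : Vec ℕ c) (γ : Vec ℕ (m * c)) →
               inFibre (suc m) c (a₀ ∷ α) β (γ₀ Vec.++ γ) ≡ isYes (sum γ₀ ≟ a₀) ∧ belowFirstRow m c α β γ₀ γ
  inFibre-++ m c a₀ α β γ₀ γ = ≡.trans
    (cong₂ _∧_ (≡.trans (cong (λ ρ → isYes (ρ ≟ᵛ (a₀ ∷ α))) (rowSums-++ m c γ₀ γ))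
                        (isYes-∷ (sum γ₀) a₀ (rowSums m c γ) α))
               (cong (λ κ → isYes (κ ≟ᵛ β)) (colSums-++ m c γ₀ γ)))
    (∧-assoc (isYes (sum γ₀ ≟ a₀)) _ _)
    where
    isYes-∷ : ∀ {k} x y (xs ys : Vec ℕ k) → isYes ((x ∷ xs) ≟ᵛ (y ∷ ys)) ≡ isYes (x ≟ y) ∧ isYes (xs ≟ᵛ ys)
    isYes-∷ x y xs ys with x ≟ y | xs ≟ᵛ ys
    ... | yes _ | yes _ = ≡.refl
    ... | yes _ | no  _ = ≡.refl
    ... | no  _ | yes _ = ≡.refl
    ... | no  _ | no  _ = ≡.refl

  completions : ∀ m c → FibreIdentity m c → ∀ a b α β (γ₀ : Vec ℕ c) →
                sum α ≡ a ∸ b → sum β ≡ a → sum γ₀ ≡ b →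
                ∑ (monos (m * c) (a ∸ b))
                  (λ γ → when (belowFirstRow m c α β γ₀ γ) (multinomial a γ₀ * multinomial (a ∸ b) γ))
                  ≡ multinomial (a ∸ b) α * (multinomial a β * binomials β γ₀)
  completions m c IH a b α β γ₀ |α|≡a∸b |β|≡a |γ₀|≡b =
    ≡.trans (≡.trans (∑-cong Γ′ (λ γ → ≡.sym (when-*ˡ (below γ) _ X))) (∑-*ˡ Γ′ _ X))
            (count (Pointwise.decidable _≤?_ γ₀ β))
    where
    Γ′    = monos (m * c) (a ∸ b)
    below = belowFirstRow m c α β γ₀
    X     = multinomial a γ₀
    Mα    = multinomial (a ∸ b) α
    Mβ    = multinomial a β
    count : Dec (γ₀ ≤ᵛ β) →
            X * ∑ Γ′ (λ γ → when (below γ) (multinomial (a ∸ b) γ)) ≡ Mα * (Mβ * binomials β γ₀)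
    count (yes γ₀≤β) = begin
        X * ∑ Γ′ (λ γ → when (below γ) (multinomial (a ∸ b) γ))
          ≡⟨ cong (X *_) (∑-cong Γ′ (λ γ → cong (λ t → when t (multinomial (a ∸ b) γ))
               (cong (isYes (rowSums m c γ ≟ᵛ α) ∧_) (columns γ)))) ⟩
        X * ∑ Γ′ (λ γ → when (inFibre m c α (β ∸ᵛ γ₀) γ) (multinomial (a ∸ b) γ))
          ≡⟨ cong (X *_) (IH (a ∸ b) α (β ∸ᵛ γ₀) |α|≡a∸b
                              (≡.trans (sum-∸ᵛ β γ₀ γ₀≤β) (cong₂ _∸_ |β|≡a |γ₀|≡b))) ⟩
        X * (Mα * multinomial (a ∸ b) (β ∸ᵛ γ₀))
          ≡⟨ solve 3 (λ x y z → x :* (y :* z) := y :* (x :* z)) ≡.refl X Mα (multinomial (a ∸ b) (β ∸ᵛ γ₀)) ⟩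
        Mα * (X * multinomial (a ∸ b) (β ∸ᵛ γ₀))
          ≡⟨ cong (Mα *_) (multinomial-∸ᵛ a b β γ₀ γ₀≤β |β|≡a |γ₀|≡b) ⟩
        Mα * (Mβ * binomials β γ₀) ∎
      where
      columns : ∀ γ → isYes ((γ₀ +ᵛ colSums m c γ) ≟ᵛ β) ≡ isYes (colSums m c γ ≟ᵛ (β ∸ᵛ γ₀))
      columns γ = isYes-⇔ ((γ₀ +ᵛ colSums m c γ) ≟ᵛ β) (colSums m c γ ≟ᵛ (β ∸ᵛ γ₀))
                    (+ᵛ≡⇒∸ᵛ γ₀ _ β) (λ eq → ≡.trans (cong (γ₀ +ᵛ_) eq) (+ᵛ-∸ᵛ γ₀ β γ₀≤β))
    count (no γ₀≰β) = begin
        X * ∑ Γ′ (λ γ → when (below γ) (multinomial (a ∸ b) γ))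
          ≡⟨ cong (X *_) (∑-zero Γ′ (λ γ → cong (λ t → when t (multinomial (a ∸ b) γ))
               (≡.trans (cong (isYes (rowSums m c γ ≟ᵛ α) ∧_)
                               (isYes-false ((γ₀ +ᵛ colSums m c γ) ≟ᵛ β) (γ₀≰β ∘ +ᵛ≡⇒≤ᵛ γ₀ _ β)))
                        (∧-zeroʳ _)))) ⟩
        X * 0                        ≡⟨ *-zeroʳ X ⟩
        0                            ≡⟨ ≡.sym (≡.trans (cong (Mα *_) (*-zeroʳ Mβ)) (*-zeroʳ Mα)) ⟩
        Mα * (Mβ * 0)                ≡⟨ cong (λ t → Mα * (Mβ * t)) (≡.sym (binomials-≰ β γ₀ γ₀≰β)) ⟩
        Mα * (Mβ * binomials β γ₀)   ∎

  fibre-identity-suc : ∀ m c → FibreIdentity m c → FibreIdentity (suc m) c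
  fibre-identity-suc m c IH a (a₀ ∷ α) β |α|≡a |β|≡a = begin
      ∑ (monos (c + m * c) a) F
        ≡⟨ ∑-split c (m * c) a F ⟩
      ∑ (monos≤ c a) (λ γ₀ → ∑ (monos (m * c) (a ∸ sum γ₀)) (λ γ → F (γ₀ Vec.++ γ)))
        ≡⟨ ∑-cong (monos≤ c a) (λ γ₀ → ≡.trans (∑-cong (monos (m * c) (a ∸ sum γ₀)) (F-++ γ₀))
                                               (∑-when (monos (m * c) (a ∸ sum γ₀)) (isYes (sum γ₀ ≟ a₀)) (H γ₀))) ⟩
      ∑ (monos≤ c a) (λ γ₀ → when (isYes (sum γ₀ ≟ a₀)) (G γ₀))
        ≡⟨ ∑-restrict c a a₀ G a₀≤a ⟩
      ∑ (monos c a₀) G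
        ≡⟨ ∑-cong-All (monos c a₀) (monos-degree c a₀) G-value ⟩
      ∑ (monos c a₀) (λ γ₀ → Mα * (Mβ * binomials β γ₀))
        ≡⟨ ≡.trans (∑-*ˡ (monos c a₀) _ Mα) (cong (Mα *_) (∑-*ˡ (monos c a₀) (binomials β) Mβ)) ⟩
      Mα * (Mβ * ∑ (monos c a₀) (binomials β))
        ≡⟨ cong (λ t → Mα * (Mβ * t)) (≡.trans (vandermonde-vec c β a₀) (cong (_C a₀) |β|≡a)) ⟩
      Mα * (Mβ * (a C a₀))
        ≡⟨ solve 3 (λ x y z → x :* (y :* z) := (z :* x) :* y) ≡.refl Mα Mβ (a C a₀) ⟩
      ((a C a₀) * Mα) * Mβ ∎
    where
    Mα = multinomial (a ∸ a₀) α
    Mβ = multinomial a β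
    a₀≤a : a₀ ≤ a
    a₀≤a = ≡.subst (a₀ ≤_) |α|≡a (m≤m+n a₀ _)
    |α|≡a∸a₀ : sum α ≡ a ∸ a₀
    |α|≡a∸a₀ = ≡.trans (≡.sym (m+n∸m≡n a₀ _)) (cong (_∸ a₀) |α|≡a)
    F : Vec ℕ (c + m * c) → ℕ
    F γ = when (inFibre (suc m) c (a₀ ∷ α) β γ) (multinomial a γ)
    H : Vec ℕ c → Vec ℕ (m * c) → ℕ
    H γ₀ γ = when (belowFirstRow m c α β γ₀ γ) (multinomial a γ₀ * multinomial (a ∸ sum γ₀) γ)
    G : Vec ℕ c → ℕ
    G γ₀ = ∑ (monos (m * c) (a ∸ sum γ₀)) (H γ₀)
    F-++ : ∀ γ₀ γ → F (γ₀ Vec.++ γ) ≡ when (isYes (sum γ₀ ≟ a₀)) (H γ₀ γ)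
    F-++ γ₀ γ = ≡.trans (cong₂ when (inFibre-++ m c a₀ α β γ₀ γ) (multinomial-++ a γ₀ γ))
                        (when-∧ (isYes (sum γ₀ ≟ a₀)) (belowFirstRow m c α β γ₀ γ) _)
    G-value : ∀ γ₀ → sum γ₀ ≡ a₀ → G γ₀ ≡ Mα * (Mβ * binomials β γ₀)
    G-value γ₀ |γ₀|≡a₀ = ≡.trans
      (completions m c IH a (sum γ₀) α β γ₀ (≡.trans |α|≡a∸a₀ (cong (a ∸_) (≡.sym |γ₀|≡a₀))) |β|≡a ≡.refl)
      (cong (λ d → multinomial (a ∸ d) α * (Mβ * binomials β γ₀)) |γ₀|≡a₀)

  fibre-identity : ∀ m c → FibreIdentity m c
  fibre-identity zero    c = fibre-identity-zero c
  fibre-identity (suc m) c = fibre-identity-suc m c (fibre-identity m c)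

module Weights {c ℓ : Level} (K : Field c ℓ) (τ : Field.Carrier K → Field.Carrier K)
  (char0 : FieldNotions.CharacteristicZero K) (τ-aut : FieldNotions.IsAutomorphism K τ) where

  open Field K
  open FieldNotions K
  open Spaces K τ using (w)
  open ListSum commutativeSemiring
  open import Relation.Binary.Reasoning.Setoid setoid
  private
    module ℕ∑ = ListSum ℕₚ.+-*-commutativeSemiring
    module τ = IsRingIsomorphism τ-aut

  fromℕ-+ : ∀ a b → fromℕ (a ℕ.+ b) ≈ fromℕ a + fromℕ b
  fromℕ-+ zero    b = sym (+-identityˡ _)
  fromℕ-+ (suc a) b = trans (+-cong refl (fromℕ-+ a b)) (sym (+-assoc _ _ _))

  fromℕ-* : ∀ a b → fromℕ (a ℕ.* b) ≈ fromℕ a * fromℕ b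
  fromℕ-* zero    b = sym (zeroˡ _)
  fromℕ-* (suc a) b = begin
    fromℕ (b ℕ.+ a ℕ.* b)            ≈⟨ fromℕ-+ b (a ℕ.* b) ⟩
    fromℕ b + fromℕ (a ℕ.* b)        ≈⟨ +-cong (sym (*-identityˡ _)) (fromℕ-* a b) ⟩
    1# * fromℕ b + fromℕ a * fromℕ b ≈⟨ sym (distribʳ _ _ _) ⟩
    (1# + fromℕ a) * fromℕ b         ∎

  fromℕ-∑ : {A : Set} (xs : List A) (f : A → ℕ) → fromℕ (ℕ∑.∑ xs f) ≈ ∑ xs (fromℕ ∘ f)
  fromℕ-∑ []       f = refl
  fromℕ-∑ (x ∷ xs) f = trans (fromℕ-+ (f x) _) (+-cong refl (fromℕ-∑ xs f))

  fromℕ-when : ∀ b x → fromℕ (ℕ∑.when b x) ≈ when b (fromℕ x)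
  fromℕ-when true  x = refl
  fromℕ-when false x = refl

  binom : {m : ℕ} → ℕ → Vec ℕ m → Carrier
  binom a γ = fromℕ (multinomial a γ)

  binom*w≈1 : ∀ {m} a (γ : Vec ℕ m) → sum γ ≡ a → binom a γ * w a γ ≈ 1#
  binom*w≈1 a γ |γ|≡a = ⁻¹-inverse (binom a γ) (nonzero (multinomial a γ) (Multinomial.multinomial≢0 a γ |γ|≡a))
    where
    nonzero : ∀ x → x ≢ 0 → ¬ (fromℕ x ≈ 0#)
    nonzero zero    x≢0 _ = x≢0 ≡.refl
    nonzero (suc x) _     = char0 x

  τ-fromℕ : ∀ x → τ (fromℕ x) ≈ fromℕ x
  τ-fromℕ zero    = τ.0#-homo
  τ-fromℕ (suc x) = trans (τ.+-homo 1# (fromℕ x)) (+-cong τ.1#-homo (τ-fromℕ x))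

  τ-⁻¹ : ∀ x → x * x ⁻¹ ≈ 1# → τ x ≈ x → τ (x ⁻¹) ≈ x ⁻¹
  τ-⁻¹ x x*x⁻¹≈1 τx≈x = begin
    τ (x ⁻¹)                ≈⟨ sym (*-identityʳ _) ⟩
    τ (x ⁻¹) * 1#           ≈⟨ *-cong refl (sym x*x⁻¹≈1) ⟩
    τ (x ⁻¹) * (x * x ⁻¹)   ≈⟨ sym (*-assoc _ _ _) ⟩
    (τ (x ⁻¹) * x) * x ⁻¹   ≈⟨ *-cong (*-cong refl (sym τx≈x)) refl ⟩
    (τ (x ⁻¹) * τ x) * x ⁻¹ ≈⟨ *-cong (sym (τ.*-homo _ _)) refl ⟩
    τ (x ⁻¹ * x) * x ⁻¹     ≈⟨ *-cong (τ.⟦⟧-cong (trans (*-comm _ _) x*x⁻¹≈1)) refl ⟩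
    τ 1# * x ⁻¹             ≈⟨ *-cong τ.1#-homo refl ⟩
    1# * x ⁻¹               ≈⟨ *-identityˡ _ ⟩
    x ⁻¹                    ∎

  τ-w : ∀ {m} a (γ : Vec ℕ m) → sum γ ≡ a → τ (w a γ) ≈ w a γ
  τ-w a γ |γ|≡a = τ-⁻¹ (binom a γ) (binom*w≈1 a γ |γ|≡a) (τ-fromℕ (multinomial a γ))

module SegreMap {c ℓ : Level} (K : Field c ℓ) (τ : Field.Carrier K → Field.Carrier K)
  (char0 : FieldNotions.CharacteristicZero K) (τ-aut : FieldNotions.IsAutomorphism K τ) (n r k : ℕ) where

  open Field K
  open FieldNotions K
  open Spaces K τ
  open Segre K using (segre; SegreSurjective; SegreIsometry)
  open Weights K τ char0 τ-aut
  open ListSum commutativeSemiring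
  open Fibres using (rowSums; colSums; inFibre; fibre-identity; sum-rowSums; sum-colSums)
  open import Algebra.Properties.Ring ring using (+-identityˡ-unique)
  open import Algebra.Properties.CommutativeSemigroup *-commutativeSemigroup using (interchange; x∙yz≈y∙xz)
  open import Relation.Binary.Reasoning.Setoid setoid
  private
    module τ = IsRingIsomorphism τ-aut

  N = suc n ℕ.* suc r

  Γ : List (Vec ℕ N)
  Γ = monos N k

  A : List (Vec ℕ (suc n))
  A = monos (suc n) k

  B : List (Vec ℕ (suc r))
  B = monos (suc r) k

  ρ : Vec ℕ N → Vec ℕ (suc n)
  ρ = rowSums (suc n) (suc r)

  κ : Vec ℕ N → Vec ℕ (suc r)
  κ = colSums (suc n) (suc r)

  fibre : Vec ℕ (suc n) → Vec ℕ (suc r) → Vec ℕ N → Bool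
  fibre = inFibre (suc n) (suc r)

  ρ-degree : ∀ γ → sum γ ≡ k → sum (ρ γ) ≡ k
  ρ-degree γ = ≡.trans (sum-rowSums (suc n) (suc r) γ)

  κ-degree : ∀ γ → sum γ ≡ k → sum (κ γ) ≡ k
  κ-degree γ = ≡.trans (sum-colSums (suc n) (suc r) γ)

  fibre-identityK : ∀ α β → sum α ≡ k → sum β ≡ k →
                    ∑ Γ (λ γ → when (fibre α β γ) (binom k γ)) ≈ binom k α * binom k β
  fibre-identityK α β |α|≡k |β|≡k = begin
    ∑ Γ (λ γ → when (fibre α β γ) (binom k γ))
      ≈⟨ sym (∑-cong Γ (λ γ → fromℕ-when (fibre α β γ) (multinomial k γ))) ⟩
    ∑ Γ (fromℕ ∘ λ γ → ℕ∑.when (fibre α β γ) (multinomial k γ))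
      ≈⟨ sym (fromℕ-∑ Γ _) ⟩
    fromℕ (ℕ∑.∑ Γ (λ γ → ℕ∑.when (fibre α β γ) (multinomial k γ)))
      ≈⟨ reflexive (cong fromℕ (fibre-identity (suc n) (suc r) k α β |α|≡k |β|≡k)) ⟩
    fromℕ (multinomial k α ℕ.* multinomial k β)
      ≈⟨ fromℕ-* (multinomial k α) (multinomial k β) ⟩
    binom k α * binom k β ∎
    where module ℕ∑ = ListSum ℕₚ.+-*-commutativeSemiring

  ∑-fibre-factor : ∀ α β (f : Vec ℕ N → Carrier) (h : Vec ℕ (suc n) → Vec ℕ (suc r) → Carrier) →
                   ∑ Γ (λ γ → when (fibre α β γ) (f γ * h (ρ γ) (κ γ))) ≈
                   ∑ Γ (λ γ → when (fibre α β γ) (f γ)) * h α β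
  ∑-fibre-factor α β f h = trans (∑-cong Γ (λ γ → on-fibre (ρ γ ≟ᵛ α) (κ γ ≟ᵛ β) (f γ)))
                                 (∑-*ʳ Γ (λ γ → when (fibre α β γ) (f γ)) (h α β))
    where
    on-fibre : ∀ {ρ′ κ′} (ρ? : Dec (ρ′ ≡ α)) (κ? : Dec (κ′ ≡ β)) x →
               when (isYes ρ? ∧ isYes κ?) (x * h ρ′ κ′) ≈ when (isYes ρ? ∧ isYes κ?) x * h α β
    on-fibre (yes ≡.refl) (yes ≡.refl) x = refl
    on-fibre (yes ≡.refl) (no _)       x = sym (zeroˡ _)
    on-fibre (no _)       κ?           x = sym (zeroˡ _)

  -- The fibres over all (α, β) of degree (k, k) partition the degree-k exponents γ.
  ∑-fibres : (g : Vec ℕ N → Carrier) →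
             ∑ A (λ α → ∑ B (λ β → ∑ Γ (λ γ → when (fibre α β γ) (g γ)))) ≈ ∑ Γ g
  ∑-fibres g = begin
    ∑ A (λ α → ∑ B (λ β → ∑ Γ (λ γ → when (fibre α β γ) (g γ))))
      ≈⟨ ∑-cong A (λ α → ∑-swap B Γ (λ β γ → when (fibre α β γ) (g γ))) ⟩
    ∑ A (λ α → ∑ Γ (λ γ → ∑ B (λ β → when (fibre α β γ) (g γ))))
      ≈⟨ ∑-swap A Γ (λ α γ → ∑ B (λ β → when (fibre α β γ) (g γ))) ⟩
    ∑ Γ (λ γ → ∑ A (λ α → ∑ B (λ β → when (fibre α β γ) (g γ))))
      ≈⟨ ∑-cong-All Γ (monos-degree N k) unique-fibre ⟩
    ∑ Γ g ∎
    where
    unique-fibre : ∀ γ → sum γ ≡ k → ∑ A (λ α → ∑ B (λ β → when (fibre α β γ) (g γ))) ≈ g γ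
    unique-fibre γ |γ|≡k = begin
      ∑ A (λ α → ∑ B (λ β → when (fibre α β γ) (g γ)))
        ≈⟨ ∑-cong A (λ α → trans (∑-cong B (λ β → when-∧ (isYes (ρ γ ≟ᵛ α)) (isYes (κ γ ≟ᵛ β)) (g γ)))
                                 (∑-when B (isYes (ρ γ ≟ᵛ α)) (λ β → when (isYes (κ γ ≟ᵛ β)) (g γ)))) ⟩
      ∑ A (λ α → when (isYes (ρ γ ≟ᵛ α)) (∑ B (λ β → when (isYes (κ γ ≟ᵛ β)) (g γ))))
        ≈⟨ ∑-cong A (λ α → when-cong (isYes (ρ γ ≟ᵛ α)) (∑-delta (suc r) k (κ γ) (g γ) (κ-degree γ |γ|≡k))) ⟩
      ∑ A (λ α → when (isYes (ρ γ ≟ᵛ α)) (g γ))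
        ≈⟨ ∑-delta (suc n) k (ρ γ) (g γ) (ρ-degree γ |γ|≡k) ⟩
      g γ ∎

  -- A right inverse of s*, and the adjoint of s* for the τ-inner products.
  lift : BiPoly (suc n) (suc r) → Poly N
  lift Q γ = binom k γ * ((w k (ρ γ) * w k (κ γ)) * Q (ρ γ) (κ γ))

  -- s* ∘ lift = id, by (★) and the cancellation of the weights.
  segre-lift : ∀ Q α β → sum α ≡ k → sum β ≡ k → segre n r k (lift Q) α β ≈ Q α β
  segre-lift Q α β |α|≡k |β|≡k = begin
    segre n r k (lift Q) α β
      ≈⟨ ∑-fibre-factor α β (binom k) (λ α β → (w k α * w k β) * Q α β) ⟩
    ∑ Γ (λ γ → when (fibre α β γ) (binom k γ)) * ((w k α * w k β) * Q α β)
      ≈⟨ *-cong (fibre-identityK α β |α|≡k |β|≡k) refl ⟩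
    (binom k α * binom k β) * ((w k α * w k β) * Q α β)
      ≈⟨ sym (*-assoc _ _ _) ⟩
    ((binom k α * binom k β) * (w k α * w k β)) * Q α β
      ≈⟨ *-cong (trans (interchange _ _ _ _) (*-cong (binom*w≈1 k α |α|≡k) (binom*w≈1 k β |β|≡k))) refl ⟩
    (1# * 1#) * Q α β
      ≈⟨ trans (*-cong (*-identityˡ 1#) refl) (*-identityˡ _) ⟩
    Q α β ∎

  τ-lift : ∀ Q γ → sum γ ≡ k → τ (lift Q γ) ≈ binom k γ * ((w k (ρ γ) * w k (κ γ)) * τ (Q (ρ γ) (κ γ)))
  τ-lift Q γ |γ|≡k = begin
    τ (binom k γ * ((w k (ρ γ) * w k (κ γ)) * Q (ρ γ) (κ γ)))
      ≈⟨ τ.*-homo _ _ ⟩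
    τ (binom k γ) * τ ((w k (ρ γ) * w k (κ γ)) * Q (ρ γ) (κ γ))
      ≈⟨ *-cong (τ-fromℕ (multinomial k γ)) (τ.*-homo _ _) ⟩
    binom k γ * (τ (w k (ρ γ) * w k (κ γ)) * τ (Q (ρ γ) (κ γ)))
      ≈⟨ *-cong refl (*-cong (trans (τ.*-homo _ _) (*-cong (τ-w k (ρ γ) (ρ-degree γ |γ|≡k))
                                                           (τ-w k (κ γ) (κ-degree γ |γ|≡k)))) refl) ⟩
    binom k γ * ((w k (ρ γ) * w k (κ γ)) * τ (Q (ρ γ) (κ γ))) ∎

  -- ⟨v, lift Q⟩ = ⟨s* v, Q⟩: the weight of γ cancels binom(k,γ), and the sum
  -- over γ regroups into sums over the fibres of (α, β).
  adjoint : ∀ v Q → ip v (lift Q) k ≈ ip₂ (segre n r k v) Q k k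
  adjoint v Q = begin
    ∑ Γ (λ γ → w k γ * (v γ * τ (lift Q γ)))
      ≈⟨ ∑-cong-All Γ (monos-degree N k) cancel-weight ⟩
    ∑ Γ (λ γ → v γ * E (ρ γ) (κ γ))
      ≈⟨ sym (∑-fibres (λ γ → v γ * E (ρ γ) (κ γ))) ⟩
    ∑ A (λ α → ∑ B (λ β → ∑ Γ (λ γ → when (fibre α β γ) (v γ * E (ρ γ) (κ γ)))))
      ≈⟨ ∑-cong A (λ α → ∑-cong B (λ β → trans (∑-fibre-factor α β v E) (x∙yz≈y∙xz _ _ _))) ⟩
    ∑ A (λ α → ∑ B (λ β → (w k α * w k β) * (segre n r k v α β * τ (Q α β)))) ∎
    where
    E : Vec ℕ (suc n) → Vec ℕ (suc r) → Carrier
    E α β = (w k α * w k β) * τ (Q α β)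
    cancel-weight : ∀ γ → sum γ ≡ k → w k γ * (v γ * τ (lift Q γ)) ≈ v γ * E (ρ γ) (κ γ)
    cancel-weight γ |γ|≡k = begin
      w k γ * (v γ * τ (lift Q γ))
        ≈⟨ *-cong refl (*-cong refl (τ-lift Q γ |γ|≡k)) ⟩
      w k γ * (v γ * (binom k γ * E (ρ γ) (κ γ)))
        ≈⟨ *-cong refl (x∙yz≈y∙xz _ _ _) ⟩
      w k γ * (binom k γ * (v γ * E (ρ γ) (κ γ)))
        ≈⟨ sym (*-assoc _ _ _) ⟩
      (w k γ * binom k γ) * (v γ * E (ρ γ) (κ γ))
        ≈⟨ *-cong (trans (*-comm _ _) (binom*w≈1 k γ |γ|≡k)) refl ⟩
      1# * (v γ * E (ρ γ) (κ γ))
        ≈⟨ *-identityˡ _ ⟩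
      v γ * E (ρ γ) (κ γ) ∎

  segre-+ : ∀ (f g : Poly N) α β → segre n r k (λ γ → f γ + g γ) α β ≈ segre n r k f α β + segre n r k g α β
  segre-+ f g α β = trans (∑-cong Γ (λ γ → when-+ (fibre α β γ))) (∑-+ Γ _ _)
    where
    when-+ : ∀ {x y} b → when b (x + y) ≈ when b x + when b y
    when-+ true  = refl
    when-+ false = sym (+-identityˡ 0#)

  segre-cong : ∀ {f g : Poly N} → (∀ γ → f γ ≈ g γ) → ∀ α β → segre n r k f α β ≈ segre n r k g α β
  segre-cong f≈g α β = ∑-cong Γ (λ γ → when-cong (fibre α β γ) (f≈g γ))

  ip-+ʳ : ∀ (v f g : Poly N) → ip v (λ γ → f γ + g γ) k ≈ ip v f k + ip v g k
  ip-+ʳ v f g = trans (∑-cong Γ (λ γ → trans (*-cong refl (trans (*-cong refl (τ.+-homo _ _)) (distribˡ _ _ _)))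
                                             (distribˡ _ _ _)))
                      (∑-+ Γ (λ γ → w k γ * (v γ * τ (f γ))) (λ γ → w k γ * (v γ * τ (g γ))))

  ip-congʳ : ∀ (v : Poly N) {f g : Poly N} → (∀ γ → f γ ≈ g γ) → ip v f k ≈ ip v g k
  ip-congʳ v f≈g = ∑-cong Γ (λ γ → *-cong refl (*-cong refl (τ.⟦⟧-cong (f≈g γ))))

  surjective : SegreSurjective n r k
  surjective Q = lift Q , segre-lift Q

  -- For v ⊥ ker s*, split v′ as (v′ − lift (s* v′)) + lift (s* v′); the first
  -- summand lies in ker s*, so ⟨v, v′⟩ = ⟨v, lift (s* v′)⟩ = ⟨s* v, s* v′⟩.
  isometry : SegreIsometry τ n r k
  isometry v v⊥ker v′ = sym (begin
    ip v v′ k                            ≈⟨ ip-congʳ v (λ γ → sym (minus-plus (v′ γ) (p γ))) ⟩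
    ip v (λ γ → u γ + p γ) k             ≈⟨ ip-+ʳ v u p ⟩
    ip v u k + ip v p k                  ≈⟨ +-cong (v⊥ker u u∈ker) refl ⟩
    0# + ip v p k                        ≈⟨ +-identityˡ _ ⟩
    ip v p k                             ≈⟨ adjoint v (segre n r k v′) ⟩
    ip₂ (segre n r k v) (segre n r k v′) k k ∎)
    where
    p u : Vec ℕ N → Carrier
    p = lift (segre n r k v′)
    u γ = v′ γ - p γ
    minus-plus : ∀ x y → (x - y) + y ≈ x
    minus-plus x y = trans (+-assoc _ _ _) (trans (+-cong refl (-‿inverseˡ y)) (+-identityʳ x))
    u∈ker : ∀ α β → sum α ≡ k → sum β ≡ k → segre n r k u α β ≈ 0#
    u∈ker α β |α|≡k |β|≡k = +-identityˡ-unique (segre n r k u α β) (segre n r k v′ α β) (begin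
      segre n r k u α β + segre n r k v′ α β ≈⟨ +-cong refl (sym (segre-lift (segre n r k v′) α β |α|≡k |β|≡k)) ⟩
      segre n r k u α β + segre n r k p α β  ≈⟨ sym (segre-+ u p α β) ⟩
      segre n r k (λ γ → u γ + p γ) α β      ≈⟨ segre-cong (λ γ → minus-plus (v′ γ) (p γ)) α β ⟩
      segre n r k v′ α β                     ∎)

lemma5p2 : {c ℓ : Level} (K : Field c ℓ) (τ : Field.Carrier K → Field.Carrier K) →
    FieldNotions.AlgebraicallyClosed K →
    FieldNotions.CharacteristicZero K →
    FieldNotions.IsAutomorphism K τ →
    FieldNotions.OrderAtMost2 K τ →
    FieldNotions.FixesSquareRoots K τ →
    (n r k : ℕ) →
    Segre.SegreSurjective K n r k × Segre.SegreIsometry K τ n r k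
lemma5p2 K τ _ char0 τ-aut _ _ n r k = surjective , isometry
  where open SegreMap K τ char0 τ-aut n r k
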